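{- For every positive integer $k$, let $f(k)$ be the maximum of $\left|\bigcup_{F\in\mathcal{F}}F\right|$ over all families $\mathcal{F}$ of $k$-element sets that are intersecting (any two members meet) and have covering number $\tau(\mathcal{F})=k$. Then \[ \frac{1}{8}\binom{2k}{k} < 2k-2+\frac{1}{2}\binom{2k-2}{k-1}\le f(k). \]
   Context: The covering number $\tau(\mathcal{F})$ of a family $\mathcal{F}$ is the minimum size of a transversal of $\mathcal{F}$, i.e. of a set meeting every member of $\mathcal{F}$. (It is known that $f(k)$ is finite.) -}

module Defs where

open import Data.Nat using (ℕ; _≤_)
open import Data.Fin.Subset using (Subset; _∩_; ∣_∣; Nonempty)
open import Data.List using (List)
open import Data.List.Relation.Unary.All using (All)
open import Data.Product using (Σ; _×_)
open import Relation.Binary.PropositionalEquality using (_≡_)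

Uniform : ∀ {n} → ℕ → List (Subset n) → Set
Uniform k 𝓕 = All (λ A → ∣ A ∣ ≡ k) 𝓕

Intersecting : ∀ {n} → List (Subset n) → Set
Intersecting 𝓕 = All (λ A → All (λ B → Nonempty (A ∩ B)) 𝓕) 𝓕

IsTransversal : ∀ {n} → List (Subset n) → Subset n → Set
IsTransversal 𝓕 T = All (λ A → Nonempty (A ∩ T)) 𝓕

HasCoveringNumber : ∀ {n} → List (Subset n) → ℕ → Set
HasCoveringNumber 𝓕 t =
  Σ (Subset _) (λ T → IsTransversal 𝓕 T × ∣ T ∣ ≡ t)
  × (∀ T → IsTransversal 𝓕 T → t ≤ ∣ T ∣)

module Submission where

-- The theorem has two independent parts.
-- (1) C(2k,k) < 8(2k-2) + 4·C(2k-2,k-1): by Pascal's rule and symmetry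
--     C(2j+2,j+1) = 2·C(2j+1,j) ≤ 4·C(2j,j), since the coefficients of a row grow
--     towards its middle; k = 1 is checked directly.
-- (2) A family witnessing f(k) ≥ 2k-2 + C(2k-2,k-1)/2.  For k = j+1 ≥ 3 take a set Y
--     of 2j points plus one extra point for each pair {P, ∁ P} of complementary
--     j-subsets of Y; the members are the sets P ∪ {extra point of {P, ∁ P}}.  Two
--     members meet in Y or share their extra point; j+1 points of Y form a transversal
--     and a pigeonhole argument excludes smaller ones; the union has 2j + C(2j,j)/2
--     points.  For k = 1, 2 (a point, a triangle) everything is decided by search.

open import Defs
open import Data.Nat using (ℕ; _+_; _*_; _∸_; _≤_; _<_)
open import Data.Nat.Combinatorics using (_C_)
open import Data.Fin.Subset using (Subset; ⋃; ∣_∣)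
open import Data.List using (List)
open import Data.Product using (Σ; _×_)

open import Data.Nat using (zero; suc; _^_; _≤?_; _<?_; z≤n; s≤s)
open import Data.Nat.Properties
open import Data.Nat.Combinatorics using (nCk≡nC[n∸k]; nCk+nC[k+1]≡[n+1]C[k+1])
open import Data.Fin using (Fin; zero; suc; _↑ˡ_; _↑ʳ_; combine; remQuot)
import Data.Fin.Properties as Fin
open import Data.Fin.Properties using (remQuot-combine)
open import Data.Fin.Subset
open import Data.Fin.Subset.Properties
open import Data.Vec using ([]; _∷_; _++_; here; there; splitAt)
open import Data.Vec.Properties using (∷-injectiveʳ)
open import Data.List using ([]; _∷_; map; length) renaming (_++_ to _++ₗ_)
open import Data.List.Properties using (length-map; length-++)
open import Data.List.Relation.Unary.All using (All; []; _∷_)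
import Data.List.Relation.Unary.All as All
open import Data.List.Relation.Unary.All.Properties using () renaming (map⁺ to All-map⁺; ++⁺ to All-++⁺)
import Data.List.Relation.Unary.Any as Any
open import Data.List.Relation.Unary.Unique.Propositional using (Unique; []; _∷_)
import Data.List.Relation.Unary.Unique.Propositional.Properties as Unique
open import Data.List.Membership.Propositional using () renaming (_∈_ to _∈ₗ_)
open import Data.List.Membership.Propositional.Properties
  using (∈-map⁺; ∈-map⁻) renaming (∈-++⁺ˡ to ∈ₗ-++⁺ˡ; ∈-++⁺ʳ to ∈ₗ-++⁺ʳ)
open import Data.Product using (_,_; proj₁; proj₂)
open import Data.Sum using (_⊎_; inj₁; inj₂; [_,_]′)
open import Function using (_∘_)
open import Relation.Nullary using (¬_; Dec; yes; no; contradiction)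
open import Relation.Nullary.Decidable using (_×-dec_; ¬?; map′; toWitness)
open import Relation.Binary.PropositionalEquality

private variable
  m n : ℕ
  x : Fin n
  p q : Subset n

pascal : ∀ n k → suc n C suc k ≡ n C k + n C suc k
pascal n k = sym (nCk+nC[k+1]≡[n+1]C[k+1] n k)

binomial-pos : ∀ {n k} → k ≤ n → 1 ≤ n C k
binomial-pos {n}     {zero}  _         = ≤-refl
binomial-pos {suc n} {suc k} (s≤s k≤n) = begin
  1                   ≤⟨ binomial-pos k≤n ⟩
  n C k               ≤⟨ m≤m+n (n C k) (n C suc k) ⟩
  n C k + n C suc k   ≡⟨ pascal n k ⟨
  suc n C suc k       ∎
  where open ≤-Reasoning

binomial-mono : ∀ n a b → a ≤ b → a + b ≤ n → n C a ≤ n C b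
binomial-mono n       zero    b       _         b≤n = binomial-pos b≤n
binomial-mono (suc n) (suc a) (suc b) (s≤s a≤b) a+b+2≤n+1 with m≤n⇒m<n∨m≡n a+b+2≤n+1
... | inj₁ (s≤s a+b+2≤n) = begin
  suc n C suc a             ≡⟨ pascal n a ⟩
  n C a + n C suc a         ≤⟨ +-mono-≤ (binomial-mono n a b a≤b a+b≤n)
                                        (binomial-mono n (suc a) (suc b) (s≤s a≤b) a+b+2≤n) ⟩
  n C b + n C suc b         ≡⟨ pascal n b ⟨
  suc n C suc b             ∎
  where
  open ≤-Reasoning
  a+b≤n : a + b ≤ n
  a+b≤n = ≤-trans (+-monoʳ-≤ a (n≤1+n b)) (≤-trans (n≤1+n (a + suc b)) a+b+2≤n)
... | inj₂ a+b+2≡n+1 = ≤-reflexive (begin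
  suc n C suc a                   ≡⟨ cong (suc n C_) (m+n∸n≡m (suc a) (suc b)) ⟨
  suc n C (suc a + suc b ∸ suc b) ≡⟨ cong (λ r → suc n C (r ∸ suc b)) a+b+2≡n+1 ⟩
  suc n C (suc n ∸ suc b)         ≡⟨ nCk≡nC[n∸k] (subst (suc b ≤_) a+b+2≡n+1 (m≤n+m (suc b) (suc a))) ⟨
  suc n C suc b                   ∎)
  where open ≡-Reasoning

central-halves : ∀ j → (suc j + suc j) C suc j ≡ 2 * (suc (j + j) C j)
central-halves j = begin
  suc r C suc j               ≡⟨ pascal r j ⟩
  r C j + r C suc j           ≡⟨ cong (r C j +_) (nCk≡nC[n∸k] (m≤n+m (suc j) j)) ⟩
  r C j + r C (r ∸ suc j)     ≡⟨ cong (λ x → r C j + r C x) (m+n∸n≡m j (suc j)) ⟩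
  r C j + r C j               ≡⟨ cong (λ x → x C j + x C j) (+-suc j j) ⟩
  suc (j + j) C j + suc (j + j) C j ≡⟨ cong (suc (j + j) C j +_) (+-identityʳ _) ⟨
  2 * (suc (j + j) C j)       ∎
  where
  open ≡-Reasoning
  r = j + suc j

-- C(2j+1, j) ≤ 2·C(2j, j): the row 2j+1 is the Pascal sum of two entries of row 2j,
-- both at most the central one.
below-middle : ∀ j → suc (j + j) C j ≤ 2 * ((j + j) C j)
below-middle zero    = s≤s z≤n
below-middle (suc i) = begin
  suc r C suc i               ≡⟨ pascal r i ⟩
  r C i + r C suc i           ≤⟨ +-monoˡ-≤ (r C suc i) (binomial-mono r i (suc i) (n≤1+n i) (n≤1+n (i + suc i))) ⟩
  r C suc i + r C suc i       ≡⟨ cong (r C suc i +_) (+-identityʳ _) ⟨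
  2 * (r C suc i)             ∎
  where
  open ≤-Reasoning
  r = suc i + suc i

central-ratio : ∀ j → (suc j + suc j) C suc j ≤ 4 * ((j + j) C j)
central-ratio j = begin
  (suc j + suc j) C suc j     ≡⟨ central-halves j ⟩
  2 * (suc (j + j) C j)       ≤⟨ *-monoʳ-≤ 2 (below-middle j) ⟩
  2 * (2 * ((j + j) C j))     ≡⟨ *-assoc 2 2 ((j + j) C j) ⟨
  4 * ((j + j) C j)           ∎
  where open ≤-Reasoning

double : ∀ k → 2 * k ≡ k + k
double k = cong (k +_) (+-identityʳ k)

double-minus-two : ∀ j → 2 * suc j ∸ 2 ≡ j + j
double-minus-two j = cong (_∸ 1) (trans (cong (j +_) (+-identityʳ (suc j))) (+-suc j j))

-- The first inequality of the theorem, multiplied by 8: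
-- C(2k,k) < 8(2k-2) + 4·C(2k-2,k-1) for every k ≥ 1.
binomial-bound : ∀ k → 1 ≤ k → (2 * k) C k < 8 * (2 * k ∸ 2) + 4 * ((2 * k ∸ 2) C (k ∸ 1))
binomial-bound (suc zero)        _ = s≤s (s≤s (s≤s z≤n))
binomial-bound k@(suc j@(suc i)) _ = begin-strict
  (2 * k) C k                              ≡⟨ cong (_C k) (double k) ⟩
  (k + k) C k                              ≤⟨ central-ratio j ⟩
  4 * ((j + j) C j)                        <⟨ m<n+m (4 * ((j + j) C j)) {8 * (j + j)} (s≤s z≤n) ⟩
  8 * (j + j) + 4 * ((j + j) C j)          ≡⟨ cong (λ n → 8 * n + 4 * (n C j)) (double-minus-two j) ⟨
  8 * (2 * k ∸ 2) + 4 * ((2 * k ∸ 2) C j)  ∎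
  where open ≤-Reasoning

meet-at : x ∈ p → x ∈ q → Nonempty (p ∩ q)
meet-at {x = x} x∈p x∈q = x , x∈p∩q⁺ (x∈p , x∈q)

∁-involutive : ∀ (p : Subset n) → ∁ (∁ p) ≡ p
∁-involutive p = ⊆-antisym (λ x∈∁∁p → x∉∁p⇒x∈p (x∈∁p⇒x∉p x∈∁∁p))
                           (λ x∈p → x∉p⇒x∈∁p (x∈p⇒x∉∁p x∈p))

-- A set on the disjoint sum Fin (m + n) is a juxtaposition p ++ q of a left part p
-- and a right part q; the points are x ↑ˡ n on the left and m ↑ʳ y on the right.
∣++∣ : ∀ (p : Subset m) (q : Subset n) → ∣ p ++ q ∣ ≡ ∣ p ∣ + ∣ q ∣
∣++∣ []            q = refl
∣++∣ (inside  ∷ p) q = cong suc (∣++∣ p q)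
∣++∣ (outside ∷ p) q = ∣++∣ p q

∈-++⁺ˡ : ∀ {p : Subset m} {q : Subset n} {x} → x ∈ p → x ↑ˡ n ∈ p ++ q
∈-++⁺ˡ here      = here
∈-++⁺ˡ (there h) = there (∈-++⁺ˡ h)

∈-++⁺ʳ : ∀ (p : Subset m) {q : Subset n} {y} → y ∈ q → m ↑ʳ y ∈ p ++ q
∈-++⁺ʳ []      h = h
∈-++⁺ʳ (_ ∷ p) h = there (∈-++⁺ʳ p h)

∈-++⁻ˡ : ∀ (p : Subset m) {q : Subset n} x → x ↑ˡ n ∈ p ++ q → x ∈ p
∈-++⁻ˡ (_ ∷ p) zero    here      = here
∈-++⁻ˡ (_ ∷ p) (suc x) (there h) = there (∈-++⁻ˡ p x h)

∈-++⁻ʳ : ∀ (p : Subset m) {q : Subset n} {y} → m ↑ʳ y ∈ p ++ q → y ∈ q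
∈-++⁻ʳ []      h         = h
∈-++⁻ʳ (_ ∷ p) (there h) = ∈-++⁻ʳ p h

meets-++⁻ : ∀ (p p′ : Subset m) {q q′ : Subset n} →
            Nonempty ((p ++ q) ∩ (p′ ++ q′)) → Nonempty (p ∩ p′) ⊎ Nonempty (q ∩ q′)
meets-++⁻ []            []             ne                = inj₂ ne
meets-++⁻ (inside  ∷ p) (inside  ∷ p′) (zero , here)     = inj₁ (zero , here)
meets-++⁻ (_       ∷ p) (_       ∷ p′) (suc x , there h) with meets-++⁻ p p′ (x , h)
... | inj₁ (y , h′) = inj₁ (suc y , there h′)
... | inj₂ ne       = inj₂ ne

meets-++⁺ˡ : ∀ {p p′ : Subset m} (q q′ : Subset n) → Nonempty (p ∩ p′) → Nonempty ((p ++ q) ∩ (p′ ++ q′))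
meets-++⁺ˡ {p = p} {p′} q q′ (x , x∈p∩p′) = meet-at (∈-++⁺ˡ (proj₁ x∈both)) (∈-++⁺ˡ (proj₂ x∈both))
  where x∈both = x∈p∩q⁻ p p′ x∈p∩p′

⊆-⋃ : ∀ {A : Subset n} (𝓕 : List (Subset n)) → A ∈ₗ 𝓕 → A ⊆ ⋃ 𝓕
⊆-⋃ (A ∷ 𝓕) (Any.here refl) = p⊆p∪q (⋃ 𝓕)
⊆-⋃ (B ∷ 𝓕) (Any.there A∈𝓕) = ⊆-trans (⊆-⋃ 𝓕 A∈𝓕) (q⊆p∪q B (⋃ 𝓕))

disjoint⇒⊆∁ : ¬ Nonempty (p ∩ q) → q ⊆ ∁ p
disjoint⇒⊆∁ p∩q=∅ x∈q = x∉p⇒x∈∁p (λ x∈p → p∩q=∅ (meet-at x∈p x∈q))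

size-pos⇒nonempty : ∀ (p : Subset n) → 1 ≤ ∣ p ∣ → Nonempty p
size-pos⇒nonempty {n} p 1≤∣p∣ with nonempty? p
... | yes ne = ne
... | no  p=∅ = contradiction (trans (cong ∣_∣ (Empty-unique p=∅)) (∣⊥∣≡0 n)) (≢-sym (<⇒≢ 1≤∣p∣))

disjoint-size : ∀ (p : Subset n) → ¬ Nonempty (p ∩ q) → ∣ p ∣ + ∣ q ∣ ≤ n
disjoint-size {n} {q} p p∩q=∅ = begin
  ∣ p ∣ + ∣ q ∣        ≤⟨ +-monoʳ-≤ ∣ p ∣ (p⊆q⇒∣p∣≤∣q∣ (disjoint⇒⊆∁ p∩q=∅)) ⟩
  ∣ p ∣ + ∣ ∁ p ∣      ≡⟨ cong (∣ p ∣ +_) (∣∁p∣≡n∸∣p∣ p) ⟩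
  ∣ p ∣ + (n ∸ ∣ p ∣)  ≡⟨ m+[n∸m]≡n (∣p∣≤n p) ⟩
  n                    ∎
  where open ≤-Reasoning

large-sets-meet : ∀ (p q : Subset n) → n < ∣ p ∣ + ∣ q ∣ → Nonempty (p ∩ q)
large-sets-meet p q n<∣p∣+∣q∣ with nonempty? (p ∩ q)
... | yes p∩q≠∅ = p∩q≠∅
... | no  p∩q=∅ = contradiction (disjoint-size p p∩q=∅) (<⇒≱ n<∣p∣+∣q∣)

⊆-size⇒≡ : p ⊆ q → ∣ q ∣ ≤ ∣ p ∣ → p ≡ q
⊆-size⇒≡ {p = []}          {[]}          _   _         = refl
⊆-size⇒≡ {p = outside ∷ p} {outside ∷ q} p⊆q q≤p       = cong (outside ∷_) (⊆-size⇒≡ (drop-∷-⊆ p⊆q) q≤p)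
⊆-size⇒≡ {p = inside  ∷ p} {inside  ∷ q} p⊆q (s≤s q≤p) = cong (inside ∷_) (⊆-size⇒≡ (drop-∷-⊆ p⊆q) q≤p)
⊆-size⇒≡ {p = outside ∷ p} {inside  ∷ q} p⊆q q<p       = contradiction (p⊆q⇒∣p∣≤∣q∣ (drop-∷-⊆ p⊆q)) (<⇒≱ q<p)
⊆-size⇒≡ {p = inside  ∷ p} {outside ∷ q} p⊆q _         = contradiction (p⊆q here) λ ()

disjoint-complement : ∀ (p : Subset n) → ¬ Nonempty (p ∩ q) → ∣ p ∣ + ∣ q ∣ ≡ n → q ≡ ∁ p
disjoint-complement {n} {q} p p∩q=∅ ∣p∣+∣q∣≡n =
  ⊆-size⇒≡ (disjoint⇒⊆∁ p∩q=∅) (≤-reflexive (begin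
    ∣ ∁ p ∣                   ≡⟨ ∣∁p∣≡n∸∣p∣ p ⟩
    n ∸ ∣ p ∣                 ≡⟨ cong (_∸ ∣ p ∣) ∣p∣+∣q∣≡n ⟨
    ∣ p ∣ + ∣ q ∣ ∸ ∣ p ∣     ≡⟨ m+n∸m≡n ∣ p ∣ ∣ q ∣ ⟩
    ∣ q ∣                     ∎))
  where open ≡-Reasoning

subset-of-size : ∀ (p : Subset n) r → r ≤ ∣ p ∣ → Σ (Subset n) λ q → q ⊆ p × ∣ q ∣ ≡ r
subset-of-size {n} p             zero    _       = ⊥ , ⊥⊆ , ∣⊥∣≡0 n
subset-of-size (inside  ∷ p) (suc r) (s≤s r≤p) with subset-of-size p r r≤p
... | q , q⊆p , ∣q∣≡r = inside ∷ q , s⊆s q⊆p , cong suc ∣q∣≡r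
subset-of-size (outside ∷ p) (suc r) r<p       with subset-of-size p (suc r) r<p
... | q , q⊆p , ∣q∣≡r = outside ∷ q , s⊆s q⊆p , ∣q∣≡r

∣─∣ : q ⊆ p → ∣ p ─ q ∣ + ∣ q ∣ ≡ ∣ p ∣
∣─∣ {q = []}          {[]}          _   = refl
∣─∣ {q = outside ∷ q} {inside  ∷ p} q⊆p = cong suc (∣─∣ (drop-∷-⊆ q⊆p))
∣─∣ {q = outside ∷ q} {outside ∷ p} q⊆p = ∣─∣ (drop-∷-⊆ q⊆p)
∣─∣ {q = inside  ∷ q} {inside  ∷ p} q⊆p = trans (+-suc ∣ p ─ q ∣ ∣ q ∣) (cong suc (∣─∣ (drop-∷-⊆ q⊆p)))
∣─∣ {q = inside  ∷ q} {outside ∷ p} q⊆p = contradiction (q⊆p here) λ ()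

x∈p─q⇒x∉q : x ∈ p ─ q → x ∉ q
x∈p─q⇒x∉q {p = _ ∷ _} {q = outside ∷ q} here      ()
x∈p─q⇒x∉q {p = _ ∷ _} {q = _ ∷ q} (there h) (there h′) = x∈p─q⇒x∉q h h′

∣∪⁅x⁆∣ : x ∉ p → ∣ p ∪ ⁅ x ⁆ ∣ ≡ suc ∣ p ∣
∣∪⁅x⁆∣ {x = zero}  {outside ∷ p} _   = cong (suc ∘ ∣_∣) (∪-identityʳ p)
∣∪⁅x⁆∣ {x = zero}  {inside  ∷ p} x∉p = contradiction here x∉p
∣∪⁅x⁆∣ {x = suc x} {inside  ∷ p} x∉p = cong suc (∣∪⁅x⁆∣ (x∉p ∘ there))
∣∪⁅x⁆∣ {x = suc x} {outside ∷ p} x∉p = ∣∪⁅x⁆∣ (x∉p ∘ there)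

-- Pigeonhole principle, injective form: if f maps p into q and is injective on p,
-- then p is no larger than q.  The image of the first point of p is removed from q.
injection-size : ∀ {p : Subset m} {q : Subset n} (f : Fin m → Fin n) →
                 (∀ {x} → x ∈ p → f x ∈ q) →
                 (∀ {x y} → x ∈ p → y ∈ p → f x ≡ f y → x ≡ y) →
                 ∣ p ∣ ≤ ∣ q ∣
injection-size {p = []}          f maps inj = z≤n
injection-size {p = outside ∷ p} f maps inj =
  injection-size (f ∘ suc) (maps ∘ there) (λ x∈p y∈p e → Fin.suc-injective (inj (there x∈p) (there y∈p) e))
injection-size {p = inside  ∷ p} {q} f maps inj = begin-strict
  ∣ p ∣              ≤⟨ injection-size {q = q - f zero} (f ∘ suc) maps′ inj′ ⟩
  ∣ q - f zero ∣     <⟨ x∈p⇒∣p-x∣<∣p∣ (maps here) ⟩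
  ∣ q ∣              ∎
  where
  open ≤-Reasoning
  inj′ : ∀ {x y} → x ∈ p → y ∈ p → f (suc x) ≡ f (suc y) → x ≡ y
  inj′ x∈p y∈p e = Fin.suc-injective (inj (there x∈p) (there y∈p) e)
  maps′ : ∀ {x} → x ∈ p → f (suc x) ∈ q - f zero
  maps′ x∈p = x∈p∧x≢y⇒x∈p-y (maps (there x∈p)) (λ e → contradiction (inj here (there x∈p) (sym e)) λ ())

distinct-members : ∀ {p : Subset n} {xs : List (Fin n)} → Unique xs → All (_∈ p) xs → length xs ≤ ∣ p ∣
distinct-members         []                 []             = z≤n
distinct-members {p = p} {x ∷ xs} (x∉xs ∷ xs-unique) (x∈p ∷ xs⊆p) = begin-strict
  length xs          ≤⟨ distinct-members xs-unique xs⊆p-x ⟩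
  ∣ p - x ∣          <⟨ x∈p⇒∣p-x∣<∣p∣ x∈p ⟩
  ∣ p ∣              ∎
  where
  open ≤-Reasoning
  xs⊆p-x : All (_∈ p - x) xs
  xs⊆p-x = All.zipWith (λ (x≢y , y∈p) → x∈p∧x≢y⇒x∈p-y y∈p (x≢y ∘ sym)) (x∉xs , xs⊆p)

subsetsOfSize : ∀ n → ℕ → List (Subset n)
subsetsOfSize zero    zero    = [] ∷ []
subsetsOfSize zero    (suc r) = []
subsetsOfSize (suc n) zero    = map (outside ∷_) (subsetsOfSize n zero)
subsetsOfSize (suc n) (suc r) = map (inside ∷_) (subsetsOfSize n r) ++ₗ map (outside ∷_) (subsetsOfSize n (suc r))

length-subsetsOfSize : ∀ n r → length (subsetsOfSize n r) ≡ n C r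
length-subsetsOfSize zero    zero    = refl
length-subsetsOfSize zero    (suc r) = refl
length-subsetsOfSize (suc n) zero    = trans (length-map _ (subsetsOfSize n zero)) (length-subsetsOfSize n zero)
length-subsetsOfSize (suc n) (suc r) = begin
  length (with-first ++ₗ without-first)             ≡⟨ length-++ with-first ⟩
  length with-first + length without-first         ≡⟨ cong₂ _+_ (length-map _ (subsetsOfSize n r))
                                                                (length-map _ (subsetsOfSize n (suc r))) ⟩
  length (subsetsOfSize n r) + length (subsetsOfSize n (suc r))
                                                   ≡⟨ cong₂ _+_ (length-subsetsOfSize n r) (length-subsetsOfSize n (suc r)) ⟩
  n C r + n C suc r                                ≡⟨ nCk+nC[k+1]≡[n+1]C[k+1] n r ⟩
  suc n C suc r                                    ∎
  where
  open ≡-Reasoning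
  with-first    = map (inside ∷_) (subsetsOfSize n r)
  without-first = map (outside ∷_) (subsetsOfSize n (suc r))

subsetsOfSize-sizes : ∀ n r → All (λ P → ∣ P ∣ ≡ r) (subsetsOfSize n r)
subsetsOfSize-sizes zero    zero    = refl ∷ []
subsetsOfSize-sizes zero    (suc r) = []
subsetsOfSize-sizes (suc n) zero    = All-map⁺ (subsetsOfSize-sizes n zero)
subsetsOfSize-sizes (suc n) (suc r) =
  All-++⁺ (All-map⁺ (All.map (cong suc) (subsetsOfSize-sizes n r))) (All-map⁺ (subsetsOfSize-sizes n (suc r)))

∈-subsetsOfSize : ∀ (P : Subset n) {r} → ∣ P ∣ ≡ r → P ∈ₗ subsetsOfSize n r
∈-subsetsOfSize []            {zero}  refl = Any.here refl
∈-subsetsOfSize (inside  ∷ P) {suc r} ∣P∣≡r =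
  ∈ₗ-++⁺ˡ (∈-map⁺ (inside ∷_) (∈-subsetsOfSize P (suc-injective ∣P∣≡r)))
∈-subsetsOfSize (outside ∷ P) {zero}  ∣P∣≡r = ∈-map⁺ (outside ∷_) (∈-subsetsOfSize P ∣P∣≡r)
∈-subsetsOfSize {suc n} (outside ∷ P) {suc r} ∣P∣≡r =
  ∈ₗ-++⁺ʳ (map (inside ∷_) (subsetsOfSize n r)) (∈-map⁺ (outside ∷_) (∈-subsetsOfSize P ∣P∣≡r))

subsetsOfSize-unique : ∀ n r → Unique (subsetsOfSize n r)
subsetsOfSize-unique zero    zero    = [] ∷ []
subsetsOfSize-unique zero    (suc r) = []
subsetsOfSize-unique (suc n) zero    = Unique.map⁺ ∷-injectiveʳ (subsetsOfSize-unique n zero)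
subsetsOfSize-unique (suc n) (suc r) =
  Unique.++⁺ (Unique.map⁺ ∷-injectiveʳ (subsetsOfSize-unique n r))
             (Unique.map⁺ ∷-injectiveʳ (subsetsOfSize-unique n (suc r)))
             different-heads
  where
  different-heads : ∀ {P} → ¬ (P ∈ₗ map (inside ∷_) (subsetsOfSize n r)
                               × P ∈ₗ map (outside ∷_) (subsetsOfSize n (suc r)))
  different-heads (P∈ , P∈′) with ∈-map⁻ (inside ∷_) P∈ | ∈-map⁻ (outside ∷_) P∈′
  ... | _ , _ , refl | _ , _ , ()

-- Injective coding of the subsets of an n-set by the points of a 2ⁿ-set:
-- the binary number whose digits are the membership bits.
bit : Side → Fin 2
bit outside = zero
bit inside  = suc zero

code : Subset n → Fin (2 ^ n)
code []      = zero
code (s ∷ p) = combine (bit s) (code p)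

code-injective : ∀ (p q : Subset n) → code p ≡ code q → p ≡ q
code-injective []      []      _ = refl
code-injective {suc n} (s ∷ p) (t ∷ q) e =
  cong₂ _∷_ (bit-injective s t (cong proj₁ digits)) (code-injective p q (cong proj₂ digits))
  where
  digits : (bit s , code p) ≡ (bit t , code q)
  digits = begin
    (bit s , code p)                        ≡⟨ remQuot-combine (bit s) (code p) ⟨
    remQuot (2 ^ n) (combine (bit s) (code p)) ≡⟨ cong (remQuot (2 ^ n)) e ⟩
    remQuot (2 ^ n) (combine (bit t) (code q)) ≡⟨ remQuot-combine (bit t) (code q) ⟩
    (bit t , code q)                        ∎
    where open ≡-Reasoning
  bit-injective : ∀ s t → bit s ≡ bit t → s ≡ t
  bit-injective outside outside _ = refl
  bit-injective inside  inside  _ = refl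
  bit-injective outside inside  ()
  bit-injective inside  outside ()

-- The canonical representative of the pair {p, ∁ p}: the one containing the first point.
canon : Subset n → Subset n
canon []            = []
canon (inside  ∷ p) = inside ∷ p
canon (outside ∷ p) = inside ∷ ∁ p

canon-∁ : ∀ (p : Subset n) → canon (∁ p) ≡ canon p
canon-∁ []            = refl
canon-∁ (inside  ∷ p) = cong (inside ∷_) (∁-involutive p)
canon-∁ (outside ∷ p) = refl

canon-injective : ∀ (p q : Subset n) → canon p ≡ canon q → p ≡ q ⊎ p ≡ ∁ q
canon-injective []            []            _ = inj₁ refl
canon-injective (inside  ∷ p) (inside  ∷ q) e = inj₁ e
canon-injective (inside  ∷ p) (outside ∷ q) e = inj₂ e
canon-injective (outside ∷ p) (inside  ∷ q) e =
  inj₂ (cong (outside ∷_) (trans (sym (∁-involutive p)) (cong ∁ (∷-injectiveʳ e))))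
canon-injective (outside ∷ p) (outside ∷ q) e =
  inj₁ (cong (outside ∷_) (trans (sym (∁-involutive p)) (trans (cong ∁ (∷-injectiveʳ e)) (∁-involutive q))))

-- 𝓕 is a k-uniform intersecting family with τ(𝓕) = k whose union has at least
-- 2k - 2 + C(2k-2, k-1)/2 points (the inequality is multiplied by 2).
Witness : ℕ → ∀ {n} → List (Subset n) → Set
Witness k 𝓕 = Uniform k 𝓕 × Intersecting 𝓕 × HasCoveringNumber 𝓕 k
              × 2 * (2 * k ∸ 2) + (2 * k ∸ 2) C (k ∸ 1) ≤ 2 * ∣ ⋃ 𝓕 ∣

-- The family for k = j + 1 with j = h + 1.  The ground set consists of the 2j points
-- of Y = Fin 2j together with the 2^(2j) codes of subsets of Y, and the members are
-- the j-subsets P of Y, each extended by the code of the pair {P, ∁ P}.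
module Construction (h : ℕ) where

  j 2j : ℕ
  j  = suc h
  2j = j + j

  member : Subset 2j → Subset (2j + 2 ^ 2j)
  member P = P ++ ⁅ code (canon P) ⁆

  𝓕 : List (Subset (2j + 2 ^ 2j))
  𝓕 = map member (subsetsOfSize 2j j)

  all-members : ∀ {ℓ} {Prop : Subset (2j + 2 ^ 2j) → Set ℓ} →
                (∀ P → ∣ P ∣ ≡ j → Prop (member P)) → All Prop 𝓕
  all-members prop = All-map⁺ (All.map (λ {P} → prop P) (subsetsOfSize-sizes 2j j))

  member∈𝓕 : ∀ P → ∣ P ∣ ≡ j → member P ∈ₗ 𝓕
  member∈𝓕 P ∣P∣≡j = ∈-map⁺ member (∈-subsetsOfSize P ∣P∣≡j)

  uniform : Uniform (suc j) 𝓕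
  uniform = all-members λ P ∣P∣≡j → begin
    ∣ P ++ ⁅ code (canon P) ⁆ ∣          ≡⟨ ∣++∣ P ⁅ code (canon P) ⁆ ⟩
    ∣ P ∣ + ∣ ⁅ code (canon P) ⁆ ∣       ≡⟨ cong₂ _+_ ∣P∣≡j (∣⁅x⁆∣≡1 (code (canon P))) ⟩
    j + 1                                ≡⟨ +-comm j 1 ⟩
    suc j                                ∎
    where open ≡-Reasoning

  -- Two members meet: either their j-sets meet in Y, or these are complementary and
  -- then both members contain the code of the pair.
  members-meet : ∀ P Q → ∣ P ∣ ≡ j → ∣ Q ∣ ≡ j → Nonempty (member P ∩ member Q)
  members-meet P Q ∣P∣≡j ∣Q∣≡j with nonempty? (P ∩ Q)
  ... | yes P∩Q≠∅ = meets-++⁺ˡ _ _ P∩Q≠∅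
  ... | no  P∩Q=∅ =
    meet-at (∈-++⁺ʳ P (x∈⁅x⁆ c)) (∈-++⁺ʳ Q (subst (λ R → c ∈ ⁅ code R ⁆) same-pair (x∈⁅x⁆ c)))
    where
    c = code (canon P)
    same-pair : canon P ≡ canon Q
    same-pair = trans (sym (canon-∁ P))
                      (cong canon (sym (disjoint-complement P P∩Q=∅ (cong₂ _+_ ∣P∣≡j ∣Q∣≡j))))

  intersecting : Intersecting 𝓕
  intersecting = all-members λ P ∣P∣≡j → all-members λ Q ∣Q∣≡j → members-meet P Q ∣P∣≡j ∣Q∣≡j

  -- Any j+1 points of Y form a transversal, since a j-set and a (j+1)-set in Y meet.
  small-transversal : Σ (Subset (2j + 2 ^ 2j)) λ T → IsTransversal 𝓕 T × ∣ T ∣ ≡ suc j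
  small-transversal = F ++ ⊥ , all-members hits , ∣F++⊥∣
    where
    F-spec = subset-of-size ⊤ (suc j) (subst (suc j ≤_) (sym (∣⊤∣≡n 2j)) (s≤s (m≤n+m j h)))
    F = proj₁ F-spec
    ∣F∣≡j+1 = proj₂ (proj₂ F-spec)
    hits : ∀ P → ∣ P ∣ ≡ j → Nonempty (member P ∩ (F ++ ⊥))
    hits P ∣P∣≡j = meets-++⁺ˡ _ ⊥
      (large-sets-meet P F (subst (2j <_) (sym (cong₂ _+_ ∣P∣≡j ∣F∣≡j+1)) (+-monoʳ-< j ≤-refl)))
    ∣F++⊥∣ : ∣ F ++ ⊥ ∣ ≡ suc j
    ∣F++⊥∣ = trans (∣++∣ F ⊥) (trans (cong₂ _+_ ∣F∣≡j+1 (∣⊥∣≡0 (2 ^ 2j))) (+-identityʳ (suc j)))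

  module _ (TY : Subset 2j) (TX : Subset (2 ^ 2j)) (T-hits : IsTransversal 𝓕 (TY ++ TX)) where

    code-caught : ∀ P → ∣ P ∣ ≡ j → P ⊆ ∁ TY → code (canon P) ∈ TX
    code-caught P ∣P∣≡j P⊆∁TY with meets-++⁻ P TY (All.lookup T-hits (member∈𝓕 P ∣P∣≡j))
    ... | inj₁ (x , x∈P∩TY) =
      contradiction (proj₂ (x∈p∩q⁻ P TY x∈P∩TY)) (x∈∁p⇒x∉p (P⊆∁TY (proj₁ (x∈p∩q⁻ P TY x∈P∩TY))))
    ... | inj₂ (y , y∈c∩TX) =
      subst (_∈ TX) (x∈⁅y⁆⇒x≡y _ (proj₁ (x∈p∩q⁻ _ TX y∈c∩TX))) (proj₂ (x∈p∩q⁻ _ TX y∈c∩TX))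

    -- Fix h points B outside TY.  For
    -- each point x of D = ∁ TY ─ B the j-set B ∪ {x} avoids TY, and the codes of the
    -- pairs of these sets are distinct, as two of the sets are neither equal nor
    -- complementary (both contain B ≠ ∅).  So ∣TX∣ ≥ ∣D∣ = (2j - ∣TY∣) - h.
    module Counting (1≤h : 1 ≤ h) (∣TY∣≤j : ∣ TY ∣ ≤ j) where

      Z = ∁ TY

      h≤∣Z∣ : h ≤ ∣ Z ∣
      h≤∣Z∣ = begin
        h             ≤⟨ n≤1+n h ⟩
        j             ≡⟨ m+n∸m≡n j j ⟨
        2j ∸ j        ≤⟨ ∸-monoʳ-≤ 2j ∣TY∣≤j ⟩
        2j ∸ ∣ TY ∣   ≡⟨ ∣∁p∣≡n∸∣p∣ TY ⟨
        ∣ Z ∣         ∎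
        where open ≤-Reasoning

      B-spec = subset-of-size Z h h≤∣Z∣
      B = proj₁ B-spec
      B⊆Z = proj₁ (proj₂ B-spec)
      ∣B∣≡h = proj₂ (proj₂ B-spec)
      b∈B = proj₂ (size-pos⇒nonempty B (subst (1 ≤_) (sym ∣B∣≡h) 1≤h))

      D = Z ─ B

      P : Fin 2j → Subset 2j
      P x = B ∪ ⁅ x ⁆

      ∣P∣≡j : ∀ {x} → x ∈ D → ∣ P x ∣ ≡ j
      ∣P∣≡j x∈D = trans (∣∪⁅x⁆∣ (x∈p─q⇒x∉q x∈D)) (cong suc ∣B∣≡h)

      P⊆Z : ∀ {x} → x ∈ D → P x ⊆ Z
      P⊆Z {x} x∈D y∈P = [ B⊆Z , (λ y∈⁅x⁆ → subst (_∈ Z) (sym (x∈⁅y⁆⇒x≡y x y∈⁅x⁆)) (p─q⊆p Z B x∈D)) ]′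
                          (x∈p∪q⁻ B ⁅ x ⁆ y∈P)

      pair-code : Fin 2j → Fin (2 ^ 2j)
      pair-code x = code (canon (P x))

      distinct-codes : ∀ {x y} → x ∈ D → y ∈ D → pair-code x ≡ pair-code y → x ≡ y
      distinct-codes {x} {y} x∈D y∈D e with canon-injective (P x) (P y) (code-injective _ _ e)
      ... | inj₁ Px≡Py = [ (λ x∈B → contradiction x∈B (x∈p─q⇒x∉q x∈D)) , x∈⁅y⁆⇒x≡y y ]′
                           (x∈p∪q⁻ B ⁅ y ⁆ (subst (x ∈_) Px≡Py (x∈p∪q⁺ (inj₂ (x∈⁅x⁆ x)))))
      ... | inj₂ Px≡∁Py =
        contradiction (x∈p∪q⁺ (inj₁ b∈B)) (x∈∁p⇒x∉p (subst (_ ∈_) Px≡∁Py (x∈p∪q⁺ (inj₁ b∈B))))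

      ∣D∣≤∣TX∣ : ∣ D ∣ ≤ ∣ TX ∣
      ∣D∣≤∣TX∣ = injection-size pair-code
                   (λ {x} x∈D → code-caught (P x) (∣P∣≡j x∈D) (P⊆Z x∈D)) distinct-codes

      X-part-large : suc j ≤ ∣ TY ∣ + ∣ TX ∣
      X-part-large = +-cancelʳ-≤ h (suc j) (∣ TY ∣ + ∣ TX ∣) (begin
        suc j + h                  ≡⟨ cong suc (+-suc h h) ⟨
        2j                         ≡⟨ m+[n∸m]≡n (≤-trans ∣TY∣≤j (m≤m+n j j)) ⟨
        ∣ TY ∣ + (2j ∸ ∣ TY ∣)      ≡⟨ cong (∣ TY ∣ +_) (∣∁p∣≡n∸∣p∣ TY) ⟨
        ∣ TY ∣ + ∣ Z ∣              ≡⟨ cong (∣ TY ∣ +_) (∣─∣ B⊆Z) ⟨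
        ∣ TY ∣ + (∣ D ∣ + ∣ B ∣)     ≤⟨ +-monoʳ-≤ ∣ TY ∣ (+-mono-≤ ∣D∣≤∣TX∣ (≤-reflexive ∣B∣≡h)) ⟩
        ∣ TY ∣ + (∣ TX ∣ + h)        ≡⟨ +-assoc ∣ TY ∣ ∣ TX ∣ h ⟨
        ∣ TY ∣ + ∣ TX ∣ + h          ∎)
        where open ≤-Reasoning

  -- Every transversal has at least j + 1 points.  This needs h ≥ 1: for h = 0 the two
  -- members share their extra point.
  transversal-large : 1 ≤ h → ∀ T → IsTransversal 𝓕 T → suc j ≤ ∣ T ∣
  transversal-large 1≤h T T-hits with splitAt 2j T
  ... | TY , TX , refl = subst (suc j ≤_) (sym (∣++∣ TY TX)) by-size-of-TY
    where
    by-size-of-TY : suc j ≤ ∣ TY ∣ + ∣ TX ∣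
    by-size-of-TY with ∣ TY ∣ ≤? j
    ... | yes ∣TY∣≤j = Counting.X-part-large TY TX T-hits 1≤h ∣TY∣≤j
    ... | no  ∣TY∣≰j = ≤-trans (≰⇒> ∣TY∣≰j) (m≤m+n ∣ TY ∣ ∣ TX ∣)

  covering-number : 1 ≤ h → HasCoveringNumber 𝓕 (suc j)
  covering-number 1≤h = small-transversal , transversal-large 1≤h

  module _ (UY : Subset 2j) (UX : Subset (2 ^ 2j)) (⋃𝓕≡UY++UX : ⋃ 𝓕 ≡ UY ++ UX) where

    member⊆UY++UX : ∀ P → ∣ P ∣ ≡ j → member P ⊆ UY ++ UX
    member⊆UY++UX P ∣P∣≡j = subst (member P ⊆_) ⋃𝓕≡UY++UX (⊆-⋃ 𝓕 (member∈𝓕 P ∣P∣≡j))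

    -- Every point of Y lies in some j-set P₀ or in its complement.
    Y-covered : 2j ≤ ∣ UY ∣
    Y-covered = subst (_≤ ∣ UY ∣) (∣⊤∣≡n 2j) (p⊆q⇒∣p∣≤∣q∣ {p = ⊤} (λ {x} _ → in-UY x))
      where
      P₀-spec = subset-of-size ⊤ j (subst (j ≤_) (sym (∣⊤∣≡n 2j)) (m≤m+n j j))
      P₀ = proj₁ P₀-spec
      ∣P₀∣≡j = proj₂ (proj₂ P₀-spec)
      ∣∁P₀∣≡j : ∣ ∁ P₀ ∣ ≡ j
      ∣∁P₀∣≡j = trans (∣∁p∣≡n∸∣p∣ P₀) (trans (cong (2j ∸_) ∣P₀∣≡j) (m+n∸m≡n j j))
      in-UY : ∀ x → x ∈ UY
      in-UY x with x ∈? P₀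
      ... | yes x∈P₀ = ∈-++⁻ˡ UY x (member⊆UY++UX P₀ ∣P₀∣≡j (∈-++⁺ˡ x∈P₀))
      ... | no  x∉P₀ = ∈-++⁻ˡ UY x (member⊆UY++UX (∁ P₀) ∣∁P₀∣≡j (∈-++⁺ˡ (x∉p⇒x∈∁p x∉P₀)))

    -- The pairs {P, ∁ P} are counted by their representatives inside ∷ Q, where Q runs
    -- over the h-subsets of the remaining 2j - 1 = h + j points; their codes are distinct.
    X-count : (h + j) C h ≤ ∣ UX ∣
    X-count = begin
      (h + j) C h                                       ≡⟨ length-subsetsOfSize (h + j) h ⟨
      length representatives                            ≡⟨ length-map (code ∘ (inside ∷_)) representatives ⟨
      length (map (code ∘ (inside ∷_)) representatives) ≤⟨ distinct-members codes-unique codes-in-UX ⟩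
      ∣ UX ∣                                            ∎
      where
      open ≤-Reasoning
      representatives = subsetsOfSize (h + j) h
      codes-unique = Unique.map⁺ (λ {Q} {Q′} e → ∷-injectiveʳ (code-injective (inside ∷ Q) (inside ∷ Q′) e))
                                 (subsetsOfSize-unique (h + j) h)
      in-UX : ∀ Q → ∣ Q ∣ ≡ h → code (inside ∷ Q) ∈ UX
      in-UX Q ∣Q∣≡h =
        ∈-++⁻ʳ UY (member⊆UY++UX (inside ∷ Q) (cong suc ∣Q∣≡h) (∈-++⁺ʳ (inside ∷ Q) (x∈⁅x⁆ _)))
      codes-in-UX = All-map⁺ (All.map (λ {Q} → in-UX Q) (subsetsOfSize-sizes (h + j) h))

  union-large : 2j + (h + j) C h ≤ ∣ ⋃ 𝓕 ∣
  union-large with splitAt 2j (⋃ 𝓕)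
  ... | UY , UX , ⋃𝓕≡UY++UX = begin
    2j + (h + j) C h    ≤⟨ +-mono-≤ (Y-covered UY UX ⋃𝓕≡UY++UX) (X-count UY UX ⋃𝓕≡UY++UX) ⟩
    ∣ UY ∣ + ∣ UX ∣     ≡⟨ ∣++∣ UY UX ⟨
    ∣ UY ++ UX ∣        ≡⟨ cong ∣_∣ ⋃𝓕≡UY++UX ⟨
    ∣ ⋃ 𝓕 ∣             ∎
    where open ≤-Reasoning

  -- For h ≥ 1, i.e. k = j + 1 ≥ 3, the family is a witness: with C(2j,j) = 2·C(2j-1,j-1)
  -- the required bound is twice union-large.
  witness : 1 ≤ h → Witness (suc j) 𝓕
  witness 1≤h = uniform , intersecting , covering-number 1≤h , bound
    where
    open ≤-Reasoning
    bound : 2 * (2 * suc j ∸ 2) + (2 * suc j ∸ 2) C j ≤ 2 * ∣ ⋃ 𝓕 ∣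
    bound = begin
      2 * (2 * suc j ∸ 2) + (2 * suc j ∸ 2) C j   ≡⟨ cong (λ r → 2 * r + r C j) (double-minus-two j) ⟩
      2 * 2j + 2j C j                             ≡⟨ cong (2 * 2j +_) (central-halves h) ⟩
      2 * 2j + 2 * (suc (h + h) C h)              ≡⟨ cong (λ r → 2 * 2j + 2 * (r C h)) (+-suc h h) ⟨
      2 * 2j + 2 * ((h + j) C h)                  ≡⟨ *-distribˡ-+ 2 2j ((h + j) C h) ⟨
      2 * (2j + (h + j) C h)                      ≤⟨ *-monoʳ-≤ 2 union-large ⟩
      2 * ∣ ⋃ 𝓕 ∣                                 ∎

-- For small families every requirement can be decided, the covering number by
-- searching through all subsets of the ground set.
transversal? : ∀ (𝓕 : List (Subset n)) T → Dec (IsTransversal 𝓕 T)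
transversal? 𝓕 T = All.all? (λ A → nonempty? (A ∩ T)) 𝓕

covering-number? : ∀ (𝓕 : List (Subset n)) t → Dec (HasCoveringNumber 𝓕 t)
covering-number? 𝓕 t =
  anySubset? (λ T → transversal? 𝓕 T ×-dec (∣ T ∣ ≟ t))
  ×-dec map′ (λ none T T-hits → ≮⇒≥ (λ ∣T∣<t → none (T , T-hits , ∣T∣<t)))
             (λ lower (T , T-hits , ∣T∣<t) → <⇒≱ ∣T∣<t (lower T T-hits))
             (¬? (anySubset? (λ T → transversal? 𝓕 T ×-dec (∣ T ∣ <? t))))

witness? : ∀ k (𝓕 : List (Subset n)) → Dec (Witness k 𝓕)
witness? k 𝓕 = All.all? (λ A → ∣ A ∣ ≟ k) 𝓕
         ×-dec All.all? (λ A → All.all? (λ B → nonempty? (A ∩ B)) 𝓕) 𝓕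
         ×-dec covering-number? 𝓕 k
         ×-dec (_ ≤? _)

point : List (Subset 1)
point = (inside ∷ []) ∷ []

triangle : List (Subset 3)
triangle = (inside  ∷ inside  ∷ outside ∷ [])
         ∷ (inside  ∷ outside ∷ inside  ∷ [])
         ∷ (outside ∷ inside  ∷ inside  ∷ [])
         ∷ []

witness-exists : ∀ k → 1 ≤ k → Σ ℕ λ n → Σ (List (Subset n)) (Witness k)
witness-exists 1                   _ = 1 , point , toWitness {a? = witness? 1 point} _
witness-exists 2                   _ = 3 , triangle , toWitness {a? = witness? 2 triangle} _
witness-exists (suc (suc (suc h))) _ = _ , Construction.𝓕 (suc h) , Construction.witness (suc h) (s≤s z≤n)

mainTheorem2 : (k : ℕ) → 1 ≤ k →
    -- (1/8) C(2k,k) < 2k-2 + (1/2) C(2k-2,k-1), multiplied by 8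
    ((2 * k) C k < 8 * (2 * k ∸ 2) + 4 * ((2 * k ∸ 2) C (k ∸ 1)))
    -- 2k-2 + (1/2) C(2k-2,k-1) ≤ f(k): some admissible family has union this large (times 2)
    × Σ ℕ (λ n → Σ (List (Subset n)) (λ 𝓕 →
        Uniform k 𝓕 × Intersecting 𝓕 × HasCoveringNumber 𝓕 k
        × 2 * (2 * k ∸ 2) + (2 * k ∸ 2) C (k ∸ 1) ≤ 2 * ∣ ⋃ 𝓕 ∣))
mainTheorem2 k 1≤k = binomial-bound k 1≤k , witness-exists k 1≤k
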